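{- Let $n\ge 2$, $D=(d_1,d_2,\dots)\in\mathbb{Y}_n$, and $1\le k\le n-1$. Then the head $l_k$ of the diagonal number $k$ of the triangulation $\Lambda_{n+2}^{ -1}(D)$ (whose tail is $d_k$) equals $$l_k=1+k+d_k-\max\big(\{m: m<k,\ m+d_m>k+d_k\}\cup\{0\}\big).$$ Geometrically: starting from the point $(d_k,-k)$ and moving along the line $x-y=d_k+k$ to the right and upwards, stopping at the first moment one hits (not merely touches) the boundary of the diagram $D$ or a coordinate axis, the abscissa $m$ of that point satisfies $l_k=m+1$.
   Context: A Young diagram is a partition $D=(d_1,d_2,\dots)$, $d_1\ge d_2\ge\dots\ge0$, finitely many nonzero, drawn in the fourth quadrant with row $k$ occupying $[0,d_k]\times[-k,-k+1]$. $\mathbb{Y}_n$ is the set of those with $d_k\le n-k$ for $1\le k\le n-1$ and $d_k=0$ for $k\ge n$. Label the vertices of a convex $(n+2)$-gon $0,\dots,n+1$ counterclockwise; $T_{n+2}$ is its set of triangulations (maximal sets of pairwise non-crossing diagonals, $n-1$ diagonals each). Tail and head of a diagonal are its smaller and larger endpoints. $\Lambda_{n+2}:T_{n+2}\to\mathbb{Y}_n$ sends a triangulation to the decreasingly ordered sequence of tails of its diagonals (padded with zeros); it is a bijection. The diagonals of a triangulation are numbered $1,\dots,n-1$ as follows: for diagonals $(a,b)$, $(c,d)$ with $a<b$, $c<d$, $(a,b)$ has the bigger number iff $a<c$, or $a=c$ and $b>d$. Thus diagonal number $k$ has tail $d_k$. -}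

module Defs where

open import Data.Nat using (ℕ; zero; suc; _+_; _∸_; _⊔_; _≤_; _<_; _<?_; _<ᵇ_; _≡ᵇ_)
open import Data.Nat.Properties using (≤-decTotalOrder)
open import Data.Bool using (Bool; _∨_; _∧_)
open import Data.Product using (_×_; _,_; proj₁; proj₂; ∃)
open import Data.List using (List; []; _∷_; length; map; filter; filterᵇ; foldr; upTo; reverse; lookup)
open import Data.List.Membership.Propositional using (_∈_; _∉_)
open import Data.List.Relation.Unary.All using (All)
open import Data.List.Relation.Unary.Unique.Propositional using (Unique)
open import Data.List.Relation.Unary.AllPairs using (AllPairs)
open import Data.Sum using (_⊎_)
open import Relation.Binary.PropositionalEquality using (_≡_)
open import Relation.Nullary using (¬_)
import Data.List.Sort

Diagonal : Set
Diagonal = ℕ × ℕ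

tail : Diagonal → ℕ
tail = proj₁

head : Diagonal → ℕ
head = proj₂

-- (a , b) is a diagonal of the convex (n+2)-gon with vertices 0 , … , n+1:
-- a < b ≤ n+1, the endpoints are not adjacent (b ≥ a+2, and not {0 , n+1}).
IsDiagonal : ℕ → Diagonal → Set
IsDiagonal n (a , b) = (suc a < b) × (b ≤ suc n) × ¬ ((a ≡ 0) × (b ≡ suc n))

Cross : Diagonal → Diagonal → Set
Cross (a , b) (c , d) = ((a < c) × (c < b) × (b < d)) ⊎ ((c < a) × (a < d) × (d < b))

record IsTriangulation (n : ℕ) (T : List Diagonal) : Set where
  field
    diagonals   : All (IsDiagonal n) T
    distinct    : Unique T
    nonCrossing : AllPairs (λ e f → ¬ Cross e f) T
    maximal     : ∀ e → IsDiagonal n e → e ∉ T → ∃ λ f → (f ∈ T) × Cross e f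

smallerNumberᵇ : Diagonal → Diagonal → Bool
smallerNumberᵇ (c , d) (a , b) = (a <ᵇ c) ∨ ((a ≡ᵇ c) ∧ (d <ᵇ b))

number : List Diagonal → Diagonal → ℕ
number T e = suc (length (filterᵇ (λ f → smallerNumberᵇ f e) T))

-- Young diagrams as sequences d : ℕ → ℕ, with d i = d_i for i ≥ 1 (d 0 unused).
-- 𝕐_n membership.
record InY (n : ℕ) (d : ℕ → ℕ) : Set where
  field
    decreasing : ∀ i → 1 ≤ i → d (suc i) ≤ d i
    bounded    : ∀ i → 1 ≤ i → i ≤ n ∸ 1 → d i ≤ n ∸ i
    vanishing  : ∀ i → n ≤ i → d i ≡ 0

-- Λ : the decreasingly ordered list of tails, padded with zeros (1-indexed).
open Data.List.Sort ≤-decTotalOrder using (sort)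

nth : List ℕ → ℕ → ℕ
nth []       _       = 0
nth (x ∷ xs) zero    = x
nth (x ∷ xs) (suc i) = nth xs i

Λ : List Diagonal → ℕ → ℕ
Λ T zero    = 0
Λ T (suc i) = nth (reverse (sort (map tail T))) i

maxBelow : (ℕ → ℕ) → ℕ → ℕ
maxBelow d k = foldr _⊔_ 0 (filter (λ m → k + d k <? m + d m) (upTo k))

headFormula : (ℕ → ℕ) → ℕ → ℕ
headFormula d k = suc (k + d k) ∸ maxBelow d k

module Submission where

-- Let e = (a , b) be the diagonal of T numbered k, N(b) the number of diagonals
-- of T with tail ≥ b, and I(a , b) the number of diagonals of T inside the
-- vertex interval [a , b] (e itself included).  The proof rests on three facts:
--   (1) the diagonals numbered before e are those strictly inside e and those
--       with tail ≥ b, so  k = I(a , b) + N(b);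
--   (2) I(a , b) + 1 + a = b: the sub-polygon a , … , b is triangulated by T.
--       The upper bound holds for any non-crossing family, the lower bound uses
--       maximality; both split [a , b] at the apex of a triangle;
--   (3) hence  b + N(b) = k + 1 + a.
-- Since the numbering sorts tails decreasingly, the tail of diagonal k is
-- Λ T k = D k.  Finally max {m < k : m + D m > k + D k} = N(b): the diagonal
-- numbered N(b) has tail ≥ b, while a diagonal numbered m > N(b) starts before b,
-- so it lies inside e and (1)–(3) give m + D m ≤ k + D k.

open import Defs
open import Data.Nat using (ℕ; zero; suc; _+_; _∸_; _⊔_; _≤_; _<_; _≥_; z≤n; s≤s; z<s; _≤?_; _<?_; _≟_)
open import Data.Nat.Properties
open import Data.Nat.Tactic.RingSolver using (solve-∀)
open import Algebra.Properties.CommutativeSemigroup +-commutativeSemigroup using (interchange)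
open import Data.Bool using () renaming (T to IsTrue)
open import Data.Bool.Properties using (T-∨; T-∧)
open import Data.Product using (_×_; _,_; proj₁; proj₂; ∃; ∃-syntax)
import Data.Product as Product
open import Data.Product.Properties using (≡-dec)
open import Data.Sum using (_⊎_; inj₁; inj₂)
import Data.Sum as Sum
open import Data.List using (List; []; _∷_; length; filter; map; reverse; foldr; upTo)
open import Data.List.Properties using (length-filter; filter-some; filter-none; filter-notAll; length-map; unfold-reverse)
open import Data.List.Membership.Propositional using (_∈_)
open import Data.List.Membership.Propositional.Properties using (∈-filter⁺; ∈-filter⁻; ∈-upTo⁺; ∈-upTo⁻)
open import Data.List.Membership.DecPropositional (≡-dec _≟_ _≟_) using (_∈?_)
open import Data.List.Relation.Unary.Any using (here; there)
import Data.List.Relation.Unary.Any as Any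
import Data.List.Relation.Unary.All as All
open All using (All)
open import Data.List.Relation.Unary.AllPairs using (AllPairs; []; _∷_)
import Data.List.Relation.Unary.AllPairs.Properties as AllPairs
open import Data.List.Relation.Unary.Linked.Properties using (Linked⇒AllPairs)
open import Data.List.Relation.Unary.Unique.Propositional using (Unique)
open import Data.List.Relation.Binary.Permutation.Propositional using (_↭_; ↭-sym; ↭-trans)
open import Data.List.Relation.Binary.Permutation.Propositional.Properties using (filter-↭; ↭-length; ↭-reverse; All-resp-↭)
open import Data.List.Sort ≤-decTotalOrder using (sort; sort-↭; sort-↗)
open import Data.List.Extrema.Nat using (argmax; argmax-all; f[⊥]≤f[argmax]; f[xs]≤f[argmax])
open import Function using (_∘_; flip)
open import Function.Bundles using (Equivalence)
open import Relation.Nullary using (¬_; Dec; yes; no; contradiction)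
open import Relation.Nullary.Decidable using (T?; _×-dec_; _⊎-dec_; ¬?)
open import Relation.Unary using (Decidable)
open import Relation.Binary.Definitions using (tri<; tri≈; tri>)
open import Relation.Binary.PropositionalEquality using (_≡_; _≢_; refl; sym; trans; cong; cong₂; subst; subst₂; module ≡-Reasoning)

-- Counting.  Elements satisfying a decidable predicate are counted as a sum of
-- indicators, so that comparisons of counts reduce to pointwise comparisons.

𝟙 : {P : Set} → Dec P → ℕ
𝟙 (yes _) = 1
𝟙 (no _)  = 0

𝟙≤1 : {P : Set} (p? : Dec P) → 𝟙 p? ≤ 1
𝟙≤1 (yes _) = s≤s z≤n
𝟙≤1 (no _)  = z≤n

𝟙-yes : {P : Set} (p? : Dec P) → P → 𝟙 p? ≡ 1
𝟙-yes (yes _) _ = refl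
𝟙-yes (no ¬p) p = contradiction p ¬p

𝟙-no : {P : Set} (p? : Dec P) → ¬ P → 𝟙 p? ≡ 0
𝟙-no (yes p) ¬p = contradiction p ¬p
𝟙-no (no _)  _  = refl

𝟙-mono : {P Q : Set} (p? : Dec P) (q? : Dec Q) → (P → Q) → 𝟙 p? ≤ 𝟙 q?
𝟙-mono (yes p) q? P⇒Q = ≤-reflexive (sym (𝟙-yes q? (P⇒Q p)))
𝟙-mono (no _)  q? P⇒Q = z≤n

𝟙-cover : {P Q R : Set} (p? : Dec P) (q? : Dec Q) (r? : Dec R) → (P → Q ⊎ R) → 𝟙 p? ≤ 𝟙 q? + 𝟙 r?
𝟙-cover (no _)  q? r? cover = z≤n
𝟙-cover (yes p) q? r? cover with cover p
... | inj₁ q = ≤-trans (≤-reflexive (sym (𝟙-yes q? q))) (m≤m+n (𝟙 q?) (𝟙 r?))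
... | inj₂ r = ≤-trans (≤-reflexive (sym (𝟙-yes r? r))) (m≤n+m (𝟙 r?) (𝟙 q?))

𝟙-disjoint : {P Q R : Set} (p? : Dec P) (q? : Dec Q) (r? : Dec R)
           → (Q → P) → (R → P) → (Q → ¬ R) → 𝟙 q? + 𝟙 r? ≤ 𝟙 p?
𝟙-disjoint p? (yes q) r? Q⇒P R⇒P disj
  rewrite 𝟙-no r? (disj q) | 𝟙-yes p? (Q⇒P q) = ≤-refl
𝟙-disjoint p? (no _) (yes r) Q⇒P R⇒P disj = ≤-reflexive (sym (𝟙-yes p? (R⇒P r)))
𝟙-disjoint p? (no _) (no _)  Q⇒P R⇒P disj = z≤n

module _ {A : Set} where

  count : {P : A → Set} → Decidable P → List A → ℕ
  count P? xs = length (filter P? xs)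

  sumOf : (A → ℕ) → List A → ℕ
  sumOf f []       = 0
  sumOf f (x ∷ xs) = f x + sumOf f xs

  sumOf-mono : ∀ {f g : A → ℕ} xs → (∀ {x} → x ∈ xs → f x ≤ g x) → sumOf f xs ≤ sumOf g xs
  sumOf-mono []       f≤g = z≤n
  sumOf-mono (x ∷ xs) f≤g = +-mono-≤ (f≤g (here refl)) (sumOf-mono xs (f≤g ∘ there))

  sumOf-mono-strict : ∀ {f g : A → ℕ} {x} xs → (∀ {y} → y ∈ xs → f y ≤ g y) → x ∈ xs → f x < g x
                    → suc (sumOf f xs) ≤ sumOf g xs
  sumOf-mono-strict (_ ∷ xs) f≤g (here refl) fx<gx = +-mono-≤ fx<gx (sumOf-mono xs (f≤g ∘ there))
  sumOf-mono-strict {f} (y ∷ xs) f≤g (there x∈) fx<gx =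
    ≤-trans (≤-reflexive (sym (+-suc (f y) (sumOf f xs))))
            (+-mono-≤ (f≤g (here refl)) (sumOf-mono-strict xs (f≤g ∘ there) x∈ fx<gx))

  sumOf-+ : ∀ (f g : A → ℕ) xs → sumOf (λ x → f x + g x) xs ≡ sumOf f xs + sumOf g xs
  sumOf-+ f g []       = refl
  sumOf-+ f g (x ∷ xs) rewrite sumOf-+ f g xs = interchange (f x) (g x) (sumOf f xs) (sumOf g xs)

  count≡sumOf : ∀ {P : A → Set} (P? : Decidable P) xs → count P? xs ≡ sumOf (λ x → 𝟙 (P? x)) xs
  count≡sumOf P? []       = refl
  count≡sumOf P? (x ∷ xs) with P? x
  ... | yes _ = cong suc (count≡sumOf P? xs)
  ... | no _  = count≡sumOf P? xs

  count-∷ : ∀ {P : A → Set} (P? : Decidable P) x xs → count P? (x ∷ xs) ≡ 𝟙 (P? x) + count P? xs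
  count-∷ P? x xs with P? x
  ... | yes _ = refl
  ... | no _  = refl

  module _ {P Q R : A → Set} (P? : Decidable P) (Q? : Decidable Q) (R? : Decidable R) where

    count-cover : ∀ xs → (∀ {x} → x ∈ xs → P x → Q x ⊎ R x) → count P? xs ≤ count Q? xs + count R? xs
    count-cover xs cover = begin
      count P? xs                                           ≡⟨ count≡sumOf P? xs ⟩
      sumOf (λ x → 𝟙 (P? x)) xs                            ≤⟨ sumOf-mono xs (λ x∈ → 𝟙-cover (P? _) (Q? _) (R? _) (cover x∈)) ⟩
      sumOf (λ x → 𝟙 (Q? x) + 𝟙 (R? x)) xs                 ≡⟨ sumOf-+ (λ x → 𝟙 (Q? x)) (λ x → 𝟙 (R? x)) xs ⟩
      sumOf (λ x → 𝟙 (Q? x)) xs + sumOf (λ x → 𝟙 (R? x)) xs ≡⟨ sym (cong₂ _+_ (count≡sumOf Q? xs) (count≡sumOf R? xs)) ⟩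
      count Q? xs + count R? xs                             ∎
      where open ≤-Reasoning

    count-disjoint : ∀ xs → (∀ {x} → x ∈ xs → Q x → P x) → (∀ {x} → x ∈ xs → R x → P x)
                   → (∀ {x} → x ∈ xs → Q x → ¬ R x) → count Q? xs + count R? xs ≤ count P? xs
    count-disjoint xs Q⇒P R⇒P disj = begin
      count Q? xs + count R? xs                             ≡⟨ cong₂ _+_ (count≡sumOf Q? xs) (count≡sumOf R? xs) ⟩
      sumOf (λ x → 𝟙 (Q? x)) xs + sumOf (λ x → 𝟙 (R? x)) xs ≡⟨ sym (sumOf-+ (λ x → 𝟙 (Q? x)) (λ x → 𝟙 (R? x)) xs) ⟩
      sumOf (λ x → 𝟙 (Q? x) + 𝟙 (R? x)) xs                 ≤⟨ sumOf-mono xs (λ x∈ → 𝟙-disjoint (P? _) (Q? _) (R? _) (Q⇒P x∈) (R⇒P x∈) (disj x∈)) ⟩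
      sumOf (λ x → 𝟙 (P? x)) xs                            ≡⟨ sym (count≡sumOf P? xs) ⟩
      count P? xs                                           ∎
      where open ≤-Reasoning

  module _ {P Q : A → Set} (P? : Decidable P) (Q? : Decidable Q) where

    count-mono : ∀ xs → (∀ {x} → x ∈ xs → P x → Q x) → count P? xs ≤ count Q? xs
    count-mono xs P⇒Q = begin
      count P? xs               ≡⟨ count≡sumOf P? xs ⟩
      sumOf (λ x → 𝟙 (P? x)) xs ≤⟨ sumOf-mono xs (λ x∈ → 𝟙-mono (P? _) (Q? _) (P⇒Q x∈)) ⟩
      sumOf (λ x → 𝟙 (Q? x)) xs ≡⟨ sym (count≡sumOf Q? xs) ⟩
      count Q? xs               ∎
      where open ≤-Reasoning

    count-mono-strict : ∀ {x} xs → (∀ {y} → y ∈ xs → P y → Q y) → x ∈ xs → Q x → ¬ P x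
                      → suc (count P? xs) ≤ count Q? xs
    count-mono-strict {x} xs P⇒Q x∈ qx ¬px = begin
      suc (count P? xs)               ≡⟨ cong suc (count≡sumOf P? xs) ⟩
      suc (sumOf (λ y → 𝟙 (P? y)) xs) ≤⟨ sumOf-mono-strict xs (λ y∈ → 𝟙-mono (P? _) (Q? _) (P⇒Q y∈)) x∈ 0<1 ⟩
      sumOf (λ y → 𝟙 (Q? y)) xs       ≡⟨ sym (count≡sumOf Q? xs) ⟩
      count Q? xs                     ∎
      where
      open ≤-Reasoning
      0<1 : 𝟙 (P? x) < 𝟙 (Q? x)
      0<1 rewrite 𝟙-no (P? x) ¬px | 𝟙-yes (Q? x) qx = s≤s z≤n

  module _ {P : A → Set} (P? : Decidable P) where

    count-pos : ∀ {x xs} → x ∈ xs → P x → 1 ≤ count P? xs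
    count-pos x∈ px = filter-some P? (Any.map (λ { refl → px }) x∈)

    count-zero : ∀ xs → (∀ {x} → x ∈ xs → ¬ P x) → count P? xs ≡ 0
    count-zero xs none = cong length (filter-none P? (All.tabulate none))

    count-↭ : ∀ {xs ys} → xs ↭ ys → count P? xs ≡ count P? ys
    count-↭ xs↭ys = ↭-length (filter-↭ P? xs↭ys)

  count-unique : (_≟_ : (x y : A) → Dec (x ≡ y)) → ∀ {xs} → Unique xs → ∀ e → count (_≟ e) xs ≤ 1
  count-unique _≟_ {[]} _               e = z≤n
  count-unique _≟_ {x ∷ xs} (x∉ ∷ uniq) e with x ≟ e
  ... | yes refl = ≤-reflexive (cong suc (count-zero (_≟ x) xs (λ y∈ y≡x → All.lookup x∉ y∈ (sym y≡x))))
  ... | no _     = count-unique _≟_ uniq e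

count-map : ∀ {A B : Set} {P : B → Set} (P? : Decidable P) (f : A → B) xs
          → count P? (map f xs) ≡ count (λ x → P? (f x)) xs
count-map P? f []       = refl
count-map P? f (x ∷ xs) with P? (f x)
... | yes _ = cong suc (count-map P? f xs)
... | no _  = count-map P? f xs

module Ranks {A : Set} {_≺_ : A → A → Set} (_≺?_ : ∀ x y → Dec (x ≺ y))
             (≺-trans : ∀ {x y z} → x ≺ y → y ≺ z → x ≺ z)
             (≺-irrefl : ∀ {x} → ¬ x ≺ x)
             (≺-connex : ∀ x y → x ≺ y ⊎ x ≡ y ⊎ y ≺ x) where

  rank : List A → A → ℕ
  rank xs y = count (_≺? y) xs

  rank-mono : ∀ xs {x y} → x ≺ y → rank xs x ≤ rank xs y
  rank-mono xs x≺y = count-mono (_≺? _) (_≺? _) xs (λ _ z≺x → ≺-trans z≺x x≺y)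

  rank-strict : ∀ {xs x y} → x ∈ xs → x ≺ y → suc (rank xs x) ≤ rank xs y
  rank-strict {xs} x∈ x≺y = count-mono-strict (_≺? _) (_≺? _) xs (λ _ z≺x → ≺-trans z≺x x≺y) x∈ x≺y ≺-irrefl

  rank-reflects : ∀ {xs x y} → y ∈ xs → rank xs x < rank xs y → x ≺ y
  rank-reflects {xs} {x} {y} y∈ rx<ry with ≺-connex x y
  ... | inj₁ x≺y        = x≺y
  ... | inj₂ (inj₁ refl) = contradiction rx<ry (<-irrefl refl)
  ... | inj₂ (inj₂ y≺x) = contradiction (rank-strict y∈ y≺x) (<-asym rx<ry)

  rank<length : ∀ {xs x} → x ∈ xs → rank xs x < length xs
  rank<length {xs} x∈ = filter-notAll (_≺? _) xs (Any.map (λ { refl → ≺-irrefl }) x∈)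

  -- In a duplicate-free list, every r < length xs is the rank of some member.
  -- Induction on the list: compare r with the rank t of the head a in the tail.
  rank-surjective : ∀ {xs} → Unique xs → ∀ {r} → r < length xs → ∃[ x ] x ∈ xs × rank xs x ≡ r
  rank-surjective {a ∷ xs} (a∉ ∷ uniq) {r} r<len with <-cmp r (rank xs a)
  ... | tri≈ _ r≡t _ = a , here refl , (begin
        rank (a ∷ xs) a         ≡⟨ count-∷ (_≺? a) a xs ⟩
        𝟙 (a ≺? a) + rank xs a  ≡⟨ cong (_+ rank xs a) (𝟙-no (a ≺? a) ≺-irrefl) ⟩
        rank xs a               ≡⟨ sym r≡t ⟩
        r                       ∎)
    where open ≡-Reasoning
  ... | tri< r<t _ _ with rank-surjective uniq (<-≤-trans r<t (length-filter (_≺? a) xs))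
  ...   | x , x∈ , rx≡r with ≺-connex x a
  ...     | inj₁ x≺a        = x , there x∈ , (begin
            rank (a ∷ xs) x         ≡⟨ count-∷ (_≺? x) a xs ⟩
            𝟙 (a ≺? x) + rank xs x  ≡⟨ cong (_+ rank xs x) (𝟙-no (a ≺? x) (λ a≺x → ≺-irrefl (≺-trans a≺x x≺a))) ⟩
            rank xs x               ≡⟨ rx≡r ⟩
            r                       ∎)
    where open ≡-Reasoning
  ...     | inj₂ (inj₁ refl) = contradiction refl (All.lookup a∉ x∈)
  ...     | inj₂ (inj₂ a≺x) = contradiction (≤-trans (rank-mono xs a≺x) (≤-reflexive rx≡r)) (<⇒≱ r<t)
  rank-surjective {a ∷ xs} (a∉ ∷ uniq) {suc r} (s≤s r<len) | tri> _ _ t<r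
    with rank-surjective uniq r<len
  ... | x , x∈ , rx≡r with ≺-connex x a
  ...   | inj₁ x≺a        = contradiction (≤-trans (≤-reflexive (cong suc (sym rx≡r))) (rank-strict x∈ x≺a)) (<⇒≱ t<r)
  ...   | inj₂ (inj₁ refl) = contradiction refl (All.lookup a∉ x∈)
  ...   | inj₂ (inj₂ a≺x) = x , there x∈ , (begin
          rank (a ∷ xs) x         ≡⟨ count-∷ (_≺? x) a xs ⟩
          𝟙 (a ≺? x) + rank xs x  ≡⟨ cong₂ _+_ (𝟙-yes (a ≺? x) a≺x) rx≡r ⟩
          suc r                   ∎)
    where open ≡-Reasoning

interval-induction : (P : ℕ → ℕ → Set)
                   → (∀ p q → (∀ j → p < j → j < q → P p j × P j q) → P p q)
                   → ∀ p q → P p q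
interval-induction P step p q = go q p q (m≤m+n q p)
  where
  -- `fuel` bounds the width q - p of the interval.
  go : ∀ fuel p q → q ≤ fuel + p → P p q
  go zero       p q q≤p = step p q (λ j p<j j<q → contradiction (<-trans p<j j<q) (≤⇒≯ q≤p))
  go (suc fuel) p q q≤  = step p q λ j p<j j<q →
    go fuel p j (≤-pred (≤-trans j<q q≤)) ,
    go fuel j q (≤-trans q≤ (≤-trans (≤-reflexive (sym (+-suc fuel p))) (+-monoʳ-≤ fuel p<j)))

-- Sorting by counting.  The entry in position i (from 0) of the decreasing
-- rearrangement of a list of numbers is characterised by how many entries are
-- at least it, resp. bigger than it.

atLeast : ℕ → List ℕ → ℕ
atLeast b = count (b ≤?_)

-- v is the entry in position i of the decreasing rearrangement of xs.
record IsIthLargest (xs : List ℕ) (i v : ℕ) : Set where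
  constructor ithLargest
  field
    fewerAbove : atLeast (suc v) xs ≤ i
    enoughFrom : i < atLeast v xs

-- The entry in position i is unique, since atLeast is antitone in its bound.
ithLargest-unique : ∀ {xs i v w} → IsIthLargest xs i v → IsIthLargest xs i w → v ≡ w
ithLargest-unique v-th w-th = ≤-antisym (≮⇒≥ (not-below w-th v-th)) (≮⇒≥ (not-below v-th w-th))
  where
  not-below : ∀ {xs i v w} → IsIthLargest xs i v → IsIthLargest xs i w → ¬ v < w
  not-below {xs} (ithLargest ≤i _) (ithLargest _ i<) v<w =
    <⇒≱ i< (≤-trans (count-mono (_ ≤?_) (_ ≤?_) xs (λ _ w≤x → <-≤-trans v<w w≤x)) ≤i)

ithLargest-↭ : ∀ {xs ys i v} → xs ↭ ys → IsIthLargest xs i v → IsIthLargest ys i v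
ithLargest-↭ {v = v} xs↭ys (ithLargest ≤i i<) =
  ithLargest (subst (_≤ _) (count-↭ (suc v ≤?_) xs↭ys) ≤i) (subst (_ <_) (count-↭ (v ≤?_) xs↭ys) i<)

nth-descending : ∀ {R} → AllPairs _≥_ R → ∀ {i} → i < length R → IsIthLargest R i (nth R i)
nth-descending {x ∷ R} (x≥R ∷ desc) {zero} _ =
  ithLargest (≤-reflexive (count-zero (suc x ≤?_) (x ∷ R) above-x))
             (count-pos (x ≤?_) (here refl) ≤-refl)
  where
  above-x : ∀ {y} → y ∈ x ∷ R → ¬ x < y
  above-x (here refl) = <-irrefl refl
  above-x (there y∈)  = ≤⇒≯ (All.lookup x≥R y∈)
nth-descending {x ∷ R} (x≥R ∷ desc) {suc i} (s≤s i<) with nth-descending desc i<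
... | ithLargest ≤i i<' = ithLargest
  (≤-trans (≤-reflexive (count-∷ (suc v ≤?_) x R)) (+-mono-≤ (𝟙≤1 (suc v ≤? x)) ≤i))
  (≤-trans (s≤s i<') (≤-reflexive (sym (trans (count-∷ (v ≤?_) x R) (cong (_+ atLeast v R) (𝟙-yes (v ≤? x) x≥v))))))
  where
  v : ℕ
  v = nth R i
  x≥v : v ≤ x
  x≥v = All.lookup x≥R (nth∈ R i<)
    where
    nth∈ : ∀ R {i} → i < length R → nth R i ∈ R
    nth∈ (y ∷ R) {zero}  _        = here refl
    nth∈ (y ∷ R) {suc i} (s≤s i<) = there (nth∈ R i<)

AllPairs-reverse : ∀ {A : Set} {R : A → A → Set} {xs} → AllPairs R xs → AllPairs (flip R) (reverse xs)
AllPairs-reverse {xs = []}     []          = []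
AllPairs-reverse {xs = x ∷ xs} (Rx ∷ Rxs) rewrite unfold-reverse x xs =
  AllPairs.++⁺ (AllPairs-reverse Rxs) (All.[] ∷ [])
               (All.map (All._∷ All.[]) (All-resp-↭ (↭-sym (↭-reverse xs)) Rx))

AllPairs-lookup : ∀ {A : Set} {R : A → A → Set} {xs x y} → AllPairs R xs → x ∈ xs → y ∈ xs
                → x ≡ y ⊎ R x y ⊎ R y x
AllPairs-lookup (Rx ∷ _)  (here refl) (here refl) = inj₁ refl
AllPairs-lookup (Rx ∷ _)  (here refl) (there y∈)  = inj₂ (inj₁ (All.lookup Rx y∈))
AllPairs-lookup (Rx ∷ _)  (there x∈)  (here refl) = inj₂ (inj₂ (All.lookup Rx x∈))
AllPairs-lookup (_ ∷ Rxs) (there x∈)  (there y∈)  = AllPairs-lookup Rxs x∈ y∈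

sortedTails : List Diagonal → List ℕ
sortedTails T = reverse (sort (map tail T))

sortedTails-↭ : ∀ T → sortedTails T ↭ map tail T
sortedTails-↭ T = ↭-trans (↭-reverse _) (sort-↭ _)

sortedTails-descending : ∀ T → AllPairs _≥_ (sortedTails T)
sortedTails-descending T = AllPairs-reverse (Linked⇒AllPairs ≤-trans (sort-↗ (map tail T)))

Λ-ithLargest : ∀ T {i} → i < length T → IsIthLargest (map tail T) i (Λ T (suc i))
Λ-ithLargest T {i} i<len = ithLargest-↭ (sortedTails-↭ T) (nth-descending (sortedTails-descending T) i<len')
  where
  i<len' : i < length (sortedTails T)
  i<len' = subst (i <_) (trans (sym (length-map tail T)) (sym (↭-length (sortedTails-↭ T)))) i<len

-- The numbering order on diagonals.

_≺_ : Diagonal → Diagonal → Set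
f ≺ e = IsTrue (smallerNumberᵇ f e)

_≺?_ : ∀ f e → Dec (f ≺ e)
f ≺? e = T? (smallerNumberᵇ f e)

≺⇒ : ∀ f e → f ≺ e → tail e < tail f ⊎ (tail e ≡ tail f × head f < head e)
≺⇒ (c , d) (a , b) f≺e with Equivalence.to T-∨ f≺e
... | inj₁ a<c = inj₁ (<ᵇ⇒< a c a<c)
... | inj₂ a≡c∧d<b with Equivalence.to T-∧ a≡c∧d<b
...   | a≡c , d<b = inj₂ (≡ᵇ⇒≡ a c a≡c , <ᵇ⇒< d b d<b)

⇒≺ : ∀ f e → tail e < tail f ⊎ (tail e ≡ tail f × head f < head e) → f ≺ e
⇒≺ f e (inj₁ a<c)          = Equivalence.from T-∨ (inj₁ (<⇒<ᵇ a<c))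
⇒≺ f e (inj₂ (a≡c , d<b)) = Equivalence.from T-∨ (inj₂ (Equivalence.from T-∧ (≡⇒≡ᵇ _ _ a≡c , <⇒<ᵇ d<b)))

≺-trans : ∀ x y z → x ≺ y → y ≺ z → x ≺ z
≺-trans x y z x≺y y≺z with ≺⇒ x y x≺y | ≺⇒ y z y≺z
... | inj₁ y<x          | inj₁ z<y          = ⇒≺ x z (inj₁ (<-trans z<y y<x))
... | inj₁ y<x          | inj₂ (z≡y , _)    = ⇒≺ x z (inj₁ (subst (_< tail x) (sym z≡y) y<x))
... | inj₂ (y≡x , _)    | inj₁ z<y          = ⇒≺ x z (inj₁ (subst (tail z <_) y≡x z<y))
... | inj₂ (y≡x , x<y) | inj₂ (z≡y , y<z) = ⇒≺ x z (inj₂ (trans z≡y y≡x , <-trans x<y y<z))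

≺-irrefl : ∀ x → ¬ x ≺ x
≺-irrefl x x≺x with ≺⇒ x x x≺x
... | inj₁ x<x       = <-irrefl refl x<x
... | inj₂ (_ , x<x) = <-irrefl refl x<x

≺-connex : ∀ x y → x ≺ y ⊎ x ≡ y ⊎ y ≺ x
≺-connex (c , d) (a , b) with <-cmp a c
... | tri< a<c _ _ = inj₁ (⇒≺ (c , d) (a , b) (inj₁ a<c))
... | tri> _ _ c<a = inj₂ (inj₂ (⇒≺ (a , b) (c , d) (inj₁ c<a)))
... | tri≈ _ refl _ with <-cmp d b
...   | tri< d<b _ _ = inj₁ (⇒≺ (c , d) (a , b) (inj₂ (refl , d<b)))
...   | tri≈ _ refl _ = inj₂ (inj₁ refl)
...   | tri> _ _ b<d = inj₂ (inj₂ (⇒≺ (a , b) (c , d) (inj₂ (refl , b<d))))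

-- Hence rank T e counts the diagonals numbered before e, and number T e = suc (rank T e).
open Ranks _≺?_ (λ {x} {y} {z} → ≺-trans x y z) (λ {x} → ≺-irrefl x) ≺-connex

number-surjective : ∀ {T} → Unique T → ∀ {m} → 1 ≤ m → m ≤ length T → ∃[ g ] g ∈ T × number T g ≡ m
number-surjective uniq {suc r} _ r<len = Product.map₂ (Product.map₂ (cong suc)) (rank-surjective uniq r<len)

tailsFrom : ℕ → List Diagonal → ℕ
tailsFrom b T = count (λ x → b ≤? tail x) T

≺⇒tail≥ : ∀ f e → f ≺ e → tail e ≤ tail f
≺⇒tail≥ f e f≺e with ≺⇒ f e f≺e
... | inj₁ e<f       = <⇒≤ e<f
... | inj₂ (e≡f , _) = ≤-reflexive e≡f

number≤tailsFrom : ∀ {T g b} → g ∈ T → b ≤ tail g → number T g ≤ tailsFrom b T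
number≤tailsFrom {T} {g} g∈ b≤g =
  count-mono-strict (_≺? g) (λ x → _ ≤? tail x) T (λ {y} _ y≺g → ≤-trans b≤g (≺⇒tail≥ y g y≺g)) g∈ b≤g (≺-irrefl g)

tailsFrom≤rank : ∀ {T g b} → tail g < b → tailsFrom b T ≤ rank T g
tailsFrom≤rank {T} {g} g<b = count-mono (λ x → _ ≤? tail x) (_≺? g) T (λ {y} _ b≤y → ⇒≺ y g (inj₁ (<-≤-trans g<b b≤y)))

tail-ithLargest : ∀ {T g} → g ∈ T → IsIthLargest (map tail T) (rank T g) (tail g)
tail-ithLargest {T} {g} g∈ = ithLargest
  (≤-trans (≤-reflexive (count-map (suc (tail g) ≤?_) tail T)) (tailsFrom≤rank {T} {g} ≤-refl))
  (≤-trans (number≤tailsFrom g∈ ≤-refl) (≤-reflexive (sym (count-map (tail g ≤?_) tail T))))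

tail≡Λ : ∀ {T g} → g ∈ T → tail g ≡ Λ T (number T g)
tail≡Λ {T} {g} g∈ = ithLargest-unique (tail-ithLargest g∈) (Λ-ithLargest T (rank<length g∈))

upper-regroup : ∀ x y p → (x + (y + 1)) + 1 + p ≡ (x + 1 + p) + (y + 1)
upper-regroup = solve-∀

lower-regroup : ∀ x y a → y + 1 + (x + 1 + a) ≡ (x + y) + 2 + a
lower-regroup = solve-∀

head-regroup : ∀ i a m → i + 1 + a + m ≡ suc (i + m + a)
head-regroup = solve-∀

swap-middle : ∀ d m i → d + (m + i) ≡ m + (i + d)
swap-middle = solve-∀

plus-two : ∀ j → j + 2 + 0 ≡ suc (suc j)
plus-two = solve-∀

-- Geometry of non-crossing families.

Cross-sym : ∀ {x y} → Cross x y → Cross y x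
Cross-sym (inj₁ h) = inj₂ h
Cross-sym (inj₂ h) = inj₁ h

Cross-irrefl : ∀ {x} → ¬ Cross x x
Cross-irrefl (inj₁ (a<a , _)) = <-irrefl refl a<a
Cross-irrefl (inj₂ (a<a , _)) = <-irrefl refl a<a

_≟ᴰ_ : (x y : Diagonal) → Dec (x ≡ y)
_≟ᴰ_ = ≡-dec _≟_ _≟_

module NonCrossingFamily {n : ℕ} {T : List Diagonal} (diagonals : All (IsDiagonal n) T)
                         (distinct : Unique T) (nonCrossing : AllPairs (λ e f → ¬ Cross e f) T) where

  wide : ∀ {x} → x ∈ T → suc (tail x) < head x
  wide x∈ = proj₁ (All.lookup diagonals x∈)

  noCross : ∀ {x y} → x ∈ T → y ∈ T → ¬ Cross x y
  noCross x∈ y∈ with AllPairs-lookup nonCrossing x∈ y∈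
  ... | inj₁ refl        = Cross-irrefl
  ... | inj₂ (inj₁ ¬xy) = ¬xy
  ... | inj₂ (inj₂ ¬yx) = ¬yx ∘ Cross-sym

  Compatible : ℕ → ℕ → Set
  Compatible a b = ∀ {x} → x ∈ T → ¬ Cross x (a , b)

  -- (a , b) is a diagonal of T or a side of the polygon.
  Edge : ℕ → ℕ → Set
  Edge a b = (a , b) ∈ T ⊎ b ≡ suc a

  edge-compatible : ∀ {a b} → Edge a b → Compatible a b
  edge-compatible (inj₁ ab∈) x∈ = noCross x∈ ab∈
  edge-compatible (inj₂ refl) x∈ (inj₁ (_ , a<d , d≤a)) = <⇒≱ a<d (≤-pred d≤a)
  edge-compatible (inj₂ refl) x∈ (inj₂ (a<c , c≤a , _)) = <⇒≱ a<c (≤-pred c≤a)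

  trapped : ∀ {a b x} → Compatible a b → x ∈ T → a < tail x → tail x < b → head x ≤ b
  trapped {b = b} {x} compat x∈ a<c c<b with head x ≤? b
  ... | yes d≤b = d≤b
  ... | no d≰b  = contradiction (a<c , c<b , ≰⇒> d≰b) (compat x∈ ∘ inj₂)

  Inside : ℕ → ℕ → Diagonal → Set
  Inside p q x = p ≤ tail x × head x ≤ q

  Inside? : ∀ p q → Decidable (Inside p q)
  Inside? p q x = (p ≤? tail x) ×-dec (head x ≤? q)

  StrictlyInside : ℕ → ℕ → Diagonal → Set
  StrictlyInside p q x = Inside p q x × x ≢ (p , q)

  StrictlyInside? : ∀ p q → Decidable (StrictlyInside p q)
  StrictlyInside? p q x = Inside? p q x ×-dec ¬? (x ≟ᴰ (p , q))

  inside strictlyInside : ℕ → ℕ → ℕ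
  inside p q         = count (Inside? p q) T
  strictlyInside p q = count (StrictlyInside? p q) T

  inside-empty : ∀ {p q} → q < 2 + p → inside p q ≡ 0
  inside-empty {p} {q} q<2+p = count-zero (Inside? p q) T
    λ x∈ (p≤c , d≤q) → <⇒≱ q<2+p (≤-trans (s≤s (s≤s p≤c)) (≤-trans (wide x∈) d≤q))

  inside-self : ∀ {a b} → (a , b) ∈ T → inside a b ≡ suc (strictlyInside a b)
  inside-self {a} {b} ab∈ = ≤-antisym
    (begin
      inside a b                                             ≤⟨ count-cover (Inside? a b) (StrictlyInside? a b) (_≟ᴰ (a , b)) T split ⟩
      strictlyInside a b + count (_≟ᴰ (a , b)) T             ≤⟨ +-monoʳ-≤ (strictlyInside a b) (count-unique _≟ᴰ_ distinct (a , b)) ⟩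
      strictlyInside a b + 1                                 ≡⟨ +-comm (strictlyInside a b) 1 ⟩
      suc (strictlyInside a b)                               ∎)
    (count-mono-strict (StrictlyInside? a b) (Inside? a b) T (λ _ → proj₁) ab∈ (≤-refl , ≤-refl) (λ s → proj₂ s refl))
    where
    open ≤-Reasoning
    split : ∀ {x} → x ∈ T → Inside a b x → StrictlyInside a b x ⊎ x ≡ (a , b)
    split {x} _ ins with x ≟ᴰ (a , b)
    ... | yes x≡ab = inj₂ x≡ab
    ... | no x≢ab  = inj₁ (ins , x≢ab)

  record Apex (p q : ℕ) : Set where
    field
      j       : ℕ
      p<j     : p < j
      j<q     : j < q
      edge    : Edge p j
      highest : ∀ {d} → (p , d) ∈ T → d < q → d ≤ j

  -- j is the largest head among the diagonals (p , d) of T with d < q, or p+1 if none.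
  apex : ∀ {p q} → suc p < q → Apex p q
  apex {p} {q} p+1<q = record
    { j       = head top
    ; p<j     = f[⊥]≤f[argmax] {f = head} (p , suc p) fan
    ; j<q     = proj₁ (proj₂ top-good)
    ; edge    = Sum.map₁ (subst (λ t → (t , head top) ∈ T) (proj₁ top-good)) (proj₂ (proj₂ top-good))
    ; highest = λ pd∈ d<q → All.lookup (f[xs]≤f[argmax] {f = head} (p , suc p) fan) (∈-filter⁺ Fan? pd∈ (refl , d<q))
    }
    where
    Fan : Diagonal → Set
    Fan x = tail x ≡ p × head x < q
    Fan? : Decidable Fan
    Fan? x = (tail x ≟ p) ×-dec (head x <? q)
    fan : List Diagonal
    fan = filter Fan? T

    Good : Diagonal → Set
    Good x = tail x ≡ p × head x < q × (x ∈ T ⊎ head x ≡ suc p)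
    top : Diagonal
    top = argmax head (p , suc p) fan
    top-good : Good top
    top-good = argmax-all head {P = Good} (refl , p+1<q , inj₂ refl)
      (All.tabulate λ x∈fan → let (x∈ , tail≡p , head<q) = ∈-filter⁻ Fan? x∈fan in tail≡p , head<q , inj₁ x∈)

  inside-upper : ∀ p q → p < q → inside p q + 1 + p ≤ q
  inside-upper = interval-induction UpperBound step
    where
    UpperBound : ℕ → ℕ → Set
    UpperBound p q = p < q → inside p q + 1 + p ≤ q

    -- split [p , q] at the apex j: every diagonal inside [p , q] other than
    -- (p , q) itself lies inside [p , j] or inside [j , q]
    step : ∀ p q → (∀ j → p < j → j < q → UpperBound p j × UpperBound j q) → UpperBound p q
    step p q IH p<q with suc p <? q
    ... | no p+1≮q = ≤-trans (≤-reflexive (cong (λ i → i + 1 + p) (inside-empty (≰⇒> p+1≮q)))) p<q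
    ... | yes p+1<q = begin
      inside p q + 1 + p                              ≤⟨ +-monoˡ-≤ p (+-monoˡ-≤ 1 split) ⟩
      (inside p j + (inside j q + count (_≟ᴰ (p , q)) T)) + 1 + p
                                                      ≤⟨ +-monoˡ-≤ p (+-monoˡ-≤ 1 (+-monoʳ-≤ (inside p j) (+-monoʳ-≤ (inside j q) (count-unique _≟ᴰ_ distinct (p , q))))) ⟩
      (inside p j + (inside j q + 1)) + 1 + p         ≡⟨ upper-regroup (inside p j) (inside j q) p ⟩
      (inside p j + 1 + p) + (inside j q + 1)         ≤⟨ +-monoˡ-≤ (inside j q + 1) (proj₁ (IH j p<j j<q) p<j) ⟩
      j + (inside j q + 1)                            ≡⟨ +-comm j (inside j q + 1) ⟩
      inside j q + 1 + j                              ≤⟨ proj₂ (IH j p<j j<q) j<q ⟩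
      q                                               ∎
      where
      open ≤-Reasoning
      open Apex (apex p+1<q)
      split : inside p q ≤ inside p j + (inside j q + count (_≟ᴰ (p , q)) T)
      split = ≤-trans (count-cover (Inside? p q) (Inside? p j) (λ x → Inside? j q x ⊎-dec (x ≟ᴰ (p , q))) T cover)
                      (+-monoʳ-≤ (inside p j) (count-cover _ (Inside? j q) (_≟ᴰ (p , q)) T (λ _ h → h)))
        where
        cover : ∀ {x} → x ∈ T → Inside p q x → Inside p j x ⊎ (Inside j q x ⊎ x ≡ (p , q))
        cover {x} x∈ (p≤c , d≤q) with j ≤? tail x | x ≟ᴰ (p , q)
        ... | yes j≤c | _        = inj₂ (inj₁ (j≤c , d≤q))
        ... | no _    | yes x≡pq = inj₂ (inj₂ x≡pq)
        ... | no j≰c  | no x≢pq with p <? tail x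
        ...   | yes p<c = inj₁ (p≤c , trapped (edge-compatible edge) x∈ p<c (≰⇒> j≰c))
        ...   | no p≮c  = inj₁ (p≤c , highest (subst (λ t → (t , head x) ∈ T) c≡p x∈) d<q)
          where
          c≡p : tail x ≡ p
          c≡p = sym (≤∧≮⇒≡ p≤c p≮c)
          d<q : head x < q
          d<q = ≤∧≢⇒< d≤q (λ d≡q → x≢pq (cong₂ _,_ c≡p d≡q))

  inside-upper-weak : ∀ {p q} → p ≤ q → inside p q + p ≤ q
  inside-upper-weak {p} {q} p≤q with suc p <? q
  ... | yes p+1<q = ≤-trans (+-monoˡ-≤ p (m≤m+n (inside p q) 1)) (inside-upper p q (<-trans (n<1+n p) p+1<q))
  ... | no p+1≮q  = subst (λ i → i + p ≤ q) (sym (inside-empty (≰⇒> p+1≮q))) p≤q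

  nested : ∀ {a b x} → (a , b) ∈ T → x ∈ T → x ≺ (a , b) → tail x < b → Inside a b x
  nested {a} {b} {x} ab∈ x∈ x≺e c<b with ≺⇒ x (a , b) x≺e
  ... | inj₁ a<c         = <⇒≤ a<c , trapped (edge-compatible (inj₁ ab∈)) x∈ a<c c<b
  ... | inj₂ (a≡c , d<b) = ≤-reflexive a≡c , <⇒≤ d<b

  rank-decomposition : ∀ {a b} → (a , b) ∈ T → rank T (a , b) ≡ strictlyInside a b + tailsFrom b T
  rank-decomposition {a} {b} ab∈ = ≤-antisym
    (count-cover (_≺? (a , b)) (StrictlyInside? a b) (λ x → b ≤? tail x) T cover)
    (count-disjoint (_≺? (a , b)) (StrictlyInside? a b) (λ x → b ≤? tail x) T
      (λ {x} _ → strictlyInside⇒≺ x)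
      (λ {x} _ b≤c → ⇒≺ x (a , b) (inj₁ (<-≤-trans (<-trans (n<1+n a) (wide ab∈)) b≤c)))
      (λ x∈ ((_ , d≤b) , _) b≤c → <⇒≱ (wide x∈) (≤-trans d≤b (≤-trans b≤c (n≤1+n _)))))
    where
    cover : ∀ {x} → x ∈ T → x ≺ (a , b) → StrictlyInside a b x ⊎ b ≤ tail x
    cover {x} x∈ x≺e with b ≤? tail x
    ... | yes b≤c = inj₂ b≤c
    ... | no b≰c  = inj₁ (nested ab∈ x∈ x≺e (≰⇒> b≰c) , λ { refl → ≺-irrefl (a , b) x≺e })
    strictlyInside⇒≺ : ∀ x → StrictlyInside a b x → x ≺ (a , b)
    strictlyInside⇒≺ x ((a≤c , d≤b) , x≢e) with a <? tail x
    ... | yes a<c = ⇒≺ x (a , b) (inj₁ a<c)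
    ... | no a≮c  = ⇒≺ x (a , b) (inj₂ (a≡c , ≤∧≢⇒< d≤b (λ d≡b → x≢e (cong₂ _,_ (sym a≡c) d≡b))))
      where
      a≡c : a ≡ tail x
      a≡c = ≤∧≮⇒≡ a≤c a≮c

  number-decomposition : ∀ {a b} → (a , b) ∈ T → number T (a , b) ≡ inside a b + tailsFrom b T
  number-decomposition {a} {b} ab∈ = begin
    suc (rank T (a , b))                        ≡⟨ cong suc (rank-decomposition ab∈) ⟩
    suc (strictlyInside a b + tailsFrom b T)    ≡⟨ cong (_+ tailsFrom b T) (sym (inside-self ab∈)) ⟩
    inside a b + tailsFrom b T                  ∎
    where open ≡-Reasoning

  tailsFrom-split : ∀ {a b d} → Compatible a b → a < d → tailsFrom d T ≤ tailsFrom b T + inside d b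
  tailsFrom-split {a} {b} {d} compat a<d = count-cover (λ x → d ≤? tail x) (λ x → b ≤? tail x) (Inside? d b) T cover
    where
    cover : ∀ {x} → x ∈ T → d ≤ tail x → b ≤ tail x ⊎ Inside d b x
    cover {x} x∈ d≤c with b ≤? tail x
    ... | yes b≤c = inj₁ b≤c
    ... | no b≰c  = inj₂ (d≤c , trapped compat x∈ (<-≤-trans a<d d≤c) (≰⇒> b≰c))

-- Triangulations: maximality yields the matching lower bound.
module Triangulated {n : ℕ} {T : List Diagonal} (isT : IsTriangulation n T) where
  open IsTriangulation isT
  open NonCrossingFamily diagonals distinct nonCrossing public

  compatible⇒edge : ∀ {a b} → 0 < a → a < b → b ≤ suc n → Compatible a b → Edge a b
  compatible⇒edge {a} {b} 0<a a<b b≤n+1 compat with b ≟ suc a | (a , b) ∈? T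
  ... | yes b≡a+1 | _       = inj₂ b≡a+1
  ... | no _      | yes ab∈ = inj₁ ab∈
  ... | no b≢a+1  | no ab∉  =
    let (x , x∈ , cross) = maximal (a , b) isDiagonal ab∉ in contradiction (Cross-sym cross) (compat x∈)
    where
    isDiagonal : IsDiagonal n (a , b)
    isDiagonal = ≤∧≢⇒< a<b (b≢a+1 ∘ sym) , b≤n+1 , λ (a≡0 , _) → <⇒≢ 0<a (sym a≡0)

  apex-compatible : ∀ {a b} → Compatible a b → (A : Apex a b) → Compatible (Apex.j A) b
  apex-compatible {a} {b} compat A {x} x∈ (inj₁ (c<j , j<d , d<b)) with <-cmp (tail x) a
  ... | tri< c<a _ _ = compat x∈ (inj₁ (c<a , <-trans (Apex.p<j A) j<d , d<b))
  ... | tri≈ _ c≡a _ = <⇒≱ j<d (Apex.highest A (subst (λ t → (t , head x) ∈ T) c≡a x∈) d<b)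
  ... | tri> _ _ a<c = edge-compatible (Apex.edge A) x∈ (inj₂ (a<c , c<j , j<d))
  apex-compatible {a} {b} compat A x∈ (inj₂ (j<c , c<b , b<d)) =
    compat x∈ (inj₂ (<-trans (Apex.p<j A) j<c , c<b , b<d))

  diagonal-< : ∀ {a b} → (a , b) ∈ T → a < b
  diagonal-< ab∈ = <-trans (n<1+n _) (wide ab∈)

  diagonal-lower : ∀ {a b} → (a , b) ∈ T → b ≤ strictlyInside a b + 2 + a → b ≤ inside a b + 1 + a
  diagonal-lower {a} {b} ab∈ b≤ = ≤-trans b≤ (≤-reflexive (begin
    strictlyInside a b + 2 + a         ≡⟨ cong (_+ a) (+-suc (strictlyInside a b) 1) ⟩
    suc (strictlyInside a b) + 1 + a   ≡⟨ cong (λ i → i + 1 + a) (sym (inside-self ab∈)) ⟩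
    inside a b + 1 + a                 ∎))
    where open ≡-Reasoning

  strictlyInside-lower : ∀ a b → Compatible a b → a < b → b ≤ suc n → b ≤ strictlyInside a b + 2 + a
  strictlyInside-lower = interval-induction LowerBound step
    where
    LowerBound : ℕ → ℕ → Set
    LowerBound a b = Compatible a b → a < b → b ≤ suc n → b ≤ strictlyInside a b + 2 + a

    edge-lower : ∀ {a b} → Edge a b → b ≤ suc n → LowerBound a b → b ≤ inside a b + 1 + a
    edge-lower {a} (inj₂ refl) _ _ = +-monoˡ-≤ a (m≤n+m 1 (inside a (suc a)))
    edge-lower (inj₁ ab∈) b≤n+1 lower = diagonal-lower ab∈ (lower (edge-compatible (inj₁ ab∈)) (diagonal-< ab∈) b≤n+1)

    step : ∀ a b → (∀ j → a < j → j < b → LowerBound a j × LowerBound j b) → LowerBound a b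
    step a b IH compat a<b b≤n+1 with suc a <? b
    ... | no a+1≮b = ≤-trans (≤-pred (≰⇒> a+1≮b)) (+-monoˡ-≤ a (≤-trans (s≤s z≤n) (m≤n+m 2 (strictlyInside a b))))
    ... | yes a+1<b = begin
      b                                             ≤⟨ edge-lower edge-jb b≤n+1 (proj₂ (IH j p<j j<q)) ⟩
      inside j b + 1 + j                            ≤⟨ +-monoʳ-≤ (inside j b + 1) (edge-lower edge (<⇒≤ (<-≤-trans j<q b≤n+1)) (proj₁ (IH j p<j j<q))) ⟩
      inside j b + 1 + (inside a j + 1 + a)         ≡⟨ lower-regroup (inside a j) (inside j b) a ⟩
      (inside a j + inside j b) + 2 + a             ≤⟨ +-monoˡ-≤ a (+-monoˡ-≤ 2 halves) ⟩
      strictlyInside a b + 2 + a                    ∎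
      where
      open ≤-Reasoning
      open Apex (apex a+1<b)
      edge-jb : Edge j b
      edge-jb = compatible⇒edge (<-≤-trans (s≤s z≤n) p<j) j<q b≤n+1 (apex-compatible compat (apex a+1<b))
      halves : inside a j + inside j b ≤ strictlyInside a b
      halves = count-disjoint (StrictlyInside? a b) (Inside? a j) (Inside? j b) T
        (λ _ (a≤c , d≤j) → (a≤c , ≤-trans d≤j (<⇒≤ j<q)) , λ { refl → <⇒≱ j<q d≤j })
        (λ _ (j≤c , d≤b) → (≤-trans (<⇒≤ p<j) j≤c , d≤b) , λ { refl → <⇒≱ p<j j≤c })
        (λ x∈ (_ , d≤j) (j≤c , _) → <⇒≱ (wide x∈) (≤-trans d≤j (≤-trans j≤c (n≤1+n _))))

  inside-exact : ∀ {a b} → (a , b) ∈ T → inside a b + 1 + a ≡ b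
  inside-exact {a} {b} ab∈ = ≤-antisym
    (inside-upper a b (diagonal-< ab∈))
    (diagonal-lower ab∈ (strictlyInside-lower a b (edge-compatible (inj₁ ab∈)) (diagonal-< ab∈) (proj₁ (proj₂ (All.lookup diagonals ab∈)))))

  head-identity : ∀ {a b} → (a , b) ∈ T → b + tailsFrom b T ≡ suc (number T (a , b) + a)
  head-identity {a} {b} ab∈ = begin
    b + tailsFrom b T                            ≡⟨ cong (_+ tailsFrom b T) (sym (inside-exact ab∈)) ⟩
    inside a b + 1 + a + tailsFrom b T           ≡⟨ head-regroup (inside a b) a (tailsFrom b T) ⟩
    suc (inside a b + tailsFrom b T + a)         ≡⟨ cong (λ k → suc (k + a)) (sym (number-decomposition ab∈)) ⟩
    suc (number T (a , b) + a)                   ∎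
    where open ≡-Reasoning

  preceding-bound : ∀ {g a b} → g ∈ T → (a , b) ∈ T → g ≺ (a , b) → tail g < b
                  → number T g + tail g ≤ number T (a , b) + a
  preceding-bound {g} {a} {b} g∈ ab∈ g≺e c<b = ≤-pred (begin
    suc (number T g + tail g)                    ≡⟨ sym (head-identity g∈) ⟩
    d + tailsFrom d T                            ≤⟨ +-monoʳ-≤ d (tailsFrom-split (edge-compatible (inj₁ ab∈)) a<d) ⟩
    d + (tailsFrom b T + inside d b)             ≡⟨ swap-middle d (tailsFrom b T) (inside d b) ⟩
    tailsFrom b T + (inside d b + d)             ≤⟨ +-monoʳ-≤ (tailsFrom b T) (inside-upper-weak d≤b) ⟩
    tailsFrom b T + b                            ≡⟨ +-comm (tailsFrom b T) b ⟩
    b + tailsFrom b T                            ≡⟨ head-identity ab∈ ⟩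
    suc (number T (a , b) + a)                   ∎)
    where
    open ≤-Reasoning
    d : ℕ
    d = head g
    g-inside : Inside a b g
    g-inside = nested ab∈ g∈ g≺e c<b
    a<d : a < d
    a<d = <-≤-trans (s≤s (proj₁ g-inside)) (<⇒≤ (wide g∈))
    d≤b : d ≤ b
    d≤b = proj₂ g-inside

  length-lower : n ∸ 1 ≤ length T
  length-lower = begin
    n ∸ 1          ≤⟨ ∸-monoˡ-≤ 1 (≤-pred (≤-trans lower (≤-reflexive (plus-two J)))) ⟩
    J              ≤⟨ length-filter (StrictlyInside? 0 (suc n)) T ⟩
    length T       ∎
    where
    open ≤-Reasoning
    J : ℕ
    J = strictlyInside 0 (suc n)
    -- nothing crosses the base (0 , n+1), so the lower bound applies to the whole polygon
    base-compatible : Compatible 0 (suc n)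
    base-compatible x∈ (inj₁ (() , _))
    base-compatible x∈ (inj₂ (_ , _ , n+1<d)) = <⇒≱ n+1<d (proj₁ (proj₂ (All.lookup diagonals x∈)))
    lower : suc n ≤ J + 2 + 0
    lower = strictlyInside-lower 0 (suc n) base-compatible z<s ≤-refl

foldr-⊔-upper : ∀ xs {m} → m ∈ xs → m ≤ foldr _⊔_ 0 xs
foldr-⊔-upper (x ∷ xs) (here refl) = m≤m⊔n x _
foldr-⊔-upper (x ∷ xs) (there m∈)  = ≤-trans (foldr-⊔-upper xs m∈) (m≤n⊔m x _)

foldr-⊔-least : ∀ xs {M} → (∀ {m} → m ∈ xs → m ≤ M) → foldr _⊔_ 0 xs ≤ M
foldr-⊔-least []       bound = z≤n
foldr-⊔-least (x ∷ xs) bound = ⊔-lub (bound (here refl)) (foldr-⊔-least xs (bound ∘ there))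

foldr-⊔-≡ : ∀ xs {M} → (∀ {m} → m ∈ xs → m ≤ M) → M ≡ 0 ⊎ M ∈ xs → foldr _⊔_ 0 xs ≡ M
foldr-⊔-≡ xs bound attained = ≤-antisym (foldr-⊔-least xs bound) (lower attained)
  where
  lower : _ ≡ 0 ⊎ _ ∈ xs → _ ≤ foldr _⊔_ 0 xs
  lower (inj₁ refl) = z≤n
  lower (inj₂ M∈)   = foldr-⊔-upper xs M∈

module Diagram {n : ℕ} {T : List Diagonal} (isT : IsTriangulation n T) (D : ℕ → ℕ)
                 (tail≡D : ∀ {g} → g ∈ T → tail g ≡ D (number T g)) where
  open Triangulated isT
  open IsTriangulation isT using (distinct)

  Above : ℕ → ℕ → Set
  Above k m = k + D k < m + D m

  module _ {a b} (e∈ : (a , b) ∈ T) where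
    k N : ℕ
    k = number T (a , b)
    N = tailsFrom b T

    -- e itself lies inside e, so N < k; and k is at most the number of diagonals.
    N<k : N < k
    N<k = ≤-trans (+-monoˡ-≤ N (count-pos (Inside? a b) e∈ (≤-refl , ≤-refl))) (≤-reflexive (sym (number-decomposition e∈)))

    k≤length : k ≤ length T
    k≤length = rank<length e∈

    -- Every m < k with m + D m > k + D k is at most N(b): otherwise the diagonal
    -- numbered m precedes e and starts before b, contradicting preceding-bound.
    above⇒≤N : ∀ {m} → m < k → Above k m → m ≤ N
    above⇒≤N {m} m<k above with m ≤? N
    ... | yes m≤N = m≤N
    ... | no m≰N with number-surjective distinct (<-≤-trans (s≤s z≤n) (≰⇒> m≰N)) (<⇒≤ (<-≤-trans m<k k≤length))
    ...   | g , g∈ , #g≡m = contradiction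
            (subst₂ _≤_ (cong₂ _+_ #g≡m (trans (tail≡D g∈) (cong D #g≡m))) (cong (k +_) (tail≡D e∈))
                    (preceding-bound g∈ e∈ g≺e g<b))
            (<⇒≱ above)
      where
      g≺e : g ≺ (a , b)
      g≺e = rank-reflects e∈ (≤-pred (subst (_< k) (sym #g≡m) m<k))
      g<b : tail g < b
      g<b with b ≤? tail g
      ... | yes b≤g = contradiction (≤-trans (≤-reflexive (sym #g≡m)) (number≤tailsFrom g∈ b≤g)) (<⇒≱ (≰⇒> m≰N))
      ... | no b≰g  = ≰⇒> b≰g

    -- N(b) itself qualifies (unless it is 0): the diagonal numbered N(b) has tail ≥ b.
    N-above : N ≡ 0 ⊎ Above k N
    N-above = from-number N refl
      where
      -- generalising N to M lets us case on whether it is 0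
      from-number : ∀ M → M ≡ N → M ≡ 0 ⊎ Above k M
      from-number zero    _   = inj₁ refl
      from-number (suc r) M≡N with number-surjective distinct (s≤s z≤n) (≤-trans (≤-reflexive M≡N) (<⇒≤ (<-≤-trans N<k k≤length)))
      ... | g , g∈ , #g≡M = inj₂ (begin-strict
        k + D k          ≡⟨ cong (k +_) (sym (tail≡D e∈)) ⟩
        k + a            <⟨ n<1+n (k + a) ⟩
        suc (k + a)      ≡⟨ sym (head-identity e∈) ⟩
        b + N            ≤⟨ +-mono-≤ b≤g (≤-reflexive (sym M≡N)) ⟩
        tail g + suc r   ≡⟨ +-comm (tail g) (suc r) ⟩
        suc r + tail g   ≡⟨ cong (suc r +_) (trans (tail≡D g∈) (cong D #g≡M)) ⟩
        suc r + D (suc r) ∎)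
        where
        open ≤-Reasoning
        b≤g : b ≤ tail g
        b≤g with b ≤? tail g
        ... | yes b≤g = b≤g
        ... | no b≰g  = contradiction (subst (_≤ rank T g) (sym M≡N) (tailsFrom≤rank {T} {g} (≰⇒> b≰g)))
                                      (<⇒≱ (subst (rank T g <_) #g≡M (n<1+n (rank T g))))

    maxBelow≡N : maxBelow D k ≡ N
    maxBelow≡N = foldr-⊔-≡ (filter Above? (upTo k)) bound (Sum.map₂ (∈-filter⁺ Above? (∈-upTo⁺ N<k)) N-above)
      where
      Above? : Decidable (Above k)
      Above? m = k + D k <? m + D m
      bound : ∀ {m} → m ∈ filter Above? (upTo k) → m ≤ N
      bound m∈ = let (m∈upTo , above) = ∈-filter⁻ Above? {xs = upTo k} m∈ in above⇒≤N (∈-upTo⁻ m∈upTo) above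

    head≡headFormula : b ≡ headFormula D k
    head≡headFormula = begin
      b                           ≡⟨ sym (m+n∸n≡m b N) ⟩
      b + N ∸ N                   ≡⟨ cong (_∸ N) (head-identity e∈) ⟩
      suc (k + a) ∸ N             ≡⟨ cong₂ (λ x y → suc (k + x) ∸ y) (tail≡D e∈) (sym maxBelow≡N) ⟩
      suc (k + D k) ∸ maxBelow D k ∎
      where open ≡-Reasoning

  diagonal-formulas : ∀ {e} → e ∈ T → tail e ≡ D (number T e) × head e ≡ headFormula D (number T e)
  diagonal-formulas e∈ = tail≡D e∈ , head≡headFormula e∈

lemma3 : (n : ℕ) → 2 ≤ n → (D : ℕ → ℕ) → InY n D
       → (T : List Diagonal) → IsTriangulation n T → (∀ i → 1 ≤ i → Λ T i ≡ D i)
       → (k : ℕ) → 1 ≤ k → k ≤ n ∸ 1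
       → (∃ λ e → (e ∈ T) × (number T e ≡ k))
         × (∀ e → e ∈ T → number T e ≡ k → (tail e ≡ D k) × (head e ≡ headFormula D k))
lemma3 n _ D _ T isT Λ≡D k 1≤k k≤n-1 = existence , formulas
  where
  open Triangulated isT using (length-lower)
  open IsTriangulation isT using (distinct)

  tail≡D : ∀ {g} → g ∈ T → tail g ≡ D (number T g)
  tail≡D g∈ = trans (tail≡Λ g∈) (Λ≡D _ (s≤s z≤n))

  -- There are at least n - 1 diagonals, so one is numbered k.
  existence : ∃ λ e → (e ∈ T) × (number T e ≡ k)
  existence = number-surjective distinct 1≤k (≤-trans k≤n-1 length-lower)

  formulas : ∀ e → e ∈ T → number T e ≡ k → (tail e ≡ D k) × (head e ≡ headFormula D k)
  formulas e e∈ #e≡k = subst (λ i → (tail e ≡ D i) × (head e ≡ headFormula D i)) #e≡k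
                             (Diagram.diagonal-formulas isT D tail≡D e∈)
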